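{- Let $k$ be a positive integer and let $u,v,w$ be vertices of $C_{2k}\square C_{2k}$. Then $d(u,v)+d(v,w)+d(u,w) \le 2\operatorname{diam}(C_{2k}\square C_{2k})$.
   Context: $C_n$ is the cycle graph with vertex set $\{0,\dots,n-1\}$, $v,w$ adjacent iff $v\equiv w\pm1 \pmod n$. The Cartesian product $G\square H$ has vertex set $V(G)\times V(H)$, with $(g,h)\sim(g',h')$ iff ($g=g'$ and $hh'\in E(H)$) or ($h=h'$ and $gg'\in E(G)$). $d(u,v)$ denotes graph distance (length of a shortest path) and $\operatorname{diam}$ the maximum distance over all vertex pairs; $\operatorname{diam}(C_{2k}\square C_{2k})=2k$. -}

module Defs where

open import Data.Nat using (ℕ; zero; suc; _+_; _≤_)
open import Data.Fin using (Fin; toℕ)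
open import Data.Product using (_×_; Σ; ∃; ∃-syntax)
open import Data.Sum using (_⊎_)
open import Relation.Binary.PropositionalEquality using (_≡_)

record Graph : Set₁ where
  field
    V   : Set
    Adj : V → V → Set
open Graph public

-- w ≡ v + 1 (mod n), for v w ∈ {0,…,n-1}
Succ : (n : ℕ) → Fin n → Fin n → Set
Succ n v w = (toℕ w ≡ suc (toℕ v)) ⊎ (suc (toℕ v) ≡ n × toℕ w ≡ 0)

C : ℕ → Graph
C n = record { V = Fin n ; Adj = λ v w → Succ n v w ⊎ Succ n w v }

_□_ : Graph → Graph → Graph
G □ H = record
  { V = V G × V H
  ; Adj = λ p q →
      (Data.Product.proj₁ p ≡ Data.Product.proj₁ q × Adj H (Data.Product.proj₂ p) (Data.Product.proj₂ q))
      ⊎ (Data.Product.proj₂ p ≡ Data.Product.proj₂ q × Adj G (Data.Product.proj₁ p) (Data.Product.proj₁ q))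
  }

data Walk (G : Graph) : V G → V G → ℕ → Set where
  nil  : ∀ {u} → Walk G u u zero
  cons : ∀ {u x v n} → Adj G u x → Walk G x v n → Walk G u v (suc n)

Dist : (G : Graph) → V G → V G → ℕ → Set
Dist G u v n = Walk G u v n × (∀ m → Walk G u v m → n ≤ m)

Diam : Graph → ℕ → Set
Diam G D = (∀ u v n → Dist G u v n → n ≤ D) × (∃[ u ] ∃[ v ] Dist G u v D)

-- The distance in C m □ C n is the sum of the cyclic distances of the two coordinates.
-- On a cycle of length n, three points cut the cycle into three arcs of total length n,
-- and each pairwise distance is at most one of these arcs, so the three distances sum to
-- at most n.  Hence the three distances in C 2k □ C 2k sum to at most 4k, while the
-- antipodal pair (0,0), (k,k) shows that the diameter is at least 2k.
module Submission where

open import Defs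
open import Data.Nat using (ℕ; zero; suc; _+_; _*_; _∸_; _⊓_; ∣_-_∣; _≤_; _<_; s≤s)
open import Data.Nat.Properties
open import Algebra.Properties.CommutativeSemigroup +-commutativeSemigroup
  using (interchange; xy∙z≈yz∙x; xy∙z≈zy∙x)
open import Data.Fin using (Fin; toℕ; fromℕ; fromℕ<)
import Data.Fin as Fin
open import Data.Fin.Properties using (toℕ-injective; toℕ<n; toℕ-fromℕ; toℕ-fromℕ<)
open import Data.Product using (_×_; _,_; proj₁; proj₂)
open import Data.Sum using (_⊎_; inj₁; inj₂)
open import Relation.Binary.PropositionalEquality

private
  variable
    G H : Graph
    m n d : ℕ

_++_ : ∀ {u v w m₁ m₂} → Walk G u v m₁ → Walk G v w m₂ → Walk G u w (m₁ + m₂)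
nil      ++ q = q
cons a p ++ q = cons a (p ++ q)

snoc : ∀ {u x v} → Walk G u x m → Adj G x v → Walk G u v (suc m)
snoc nil        a = cons a nil
snoc (cons b p) a = cons b (snoc p a)

reverse : (∀ {x y} → Adj G x y → Adj G y x) → ∀ {u v} → Walk G u v m → Walk G v u m
reverse adj-sym nil        = nil
reverse adj-sym (cons a p) = snoc (reverse adj-sym p) (adj-sym a)

record Lipschitz (G : Graph) (f : V G → V G → ℕ) : Set where
  field
    diagonal : ∀ u → f u u ≡ 0
    adjacent : ∀ {u x} v → Adj G u x → f u v ≤ suc (f x v)

  ≤-length : ∀ {u v} → Walk G u v m → f u v ≤ m
  ≤-length {u = u} nil = ≤-reflexive (diagonal u)
  ≤-length {v = v} (cons a p) = ≤-trans (adjacent v a) (s≤s (≤-length p))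

  Dist-exact : ∀ {u v} → Walk G u v (f u v) → Dist G u v (f u v)
  Dist-exact p = p , λ _ → ≤-length

open Lipschitz

Dist-≡ : ∀ {f u v} → Lipschitz G f → Walk G u v (f u v) → Dist G u v d → d ≡ f u v
Dist-≡ f-lip shortest (walk , minimal) =
  ≤-antisym (minimal _ shortest) (≤-length f-lip walk)

_⊕_ : {A B : Set} → (A → A → ℕ) → (B → B → ℕ) → A × B → A × B → ℕ
(f ⊕ h) p q = f (proj₁ p) (proj₁ q) + h (proj₂ p) (proj₂ q)

walk-□ˡ : ∀ {a b} (c : V H) → Walk G a b m → Walk (G □ H) (a , c) (b , c) m
walk-□ˡ c nil        = nil
walk-□ˡ c (cons a p) = cons (inj₂ (refl , a)) (walk-□ˡ c p)

walk-□ʳ : ∀ {a b} (c : V G) → Walk H a b m → Walk (G □ H) (c , a) (c , b) m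
walk-□ʳ c nil        = nil
walk-□ʳ c (cons a p) = cons (inj₁ (refl , a)) (walk-□ʳ c p)

walk-□ : ∀ {a b c e m₁ m₂} → Walk G a b m₁ → Walk H c e m₂ →
         Walk (G □ H) (a , c) (b , e) (m₁ + m₂)
walk-□ {b = b} {c = c} p q = walk-□ˡ c p ++ walk-□ʳ b q

Lipschitz-□ : ∀ {f h} → Lipschitz G f → Lipschitz H h → Lipschitz (G □ H) (f ⊕ h)
Lipschitz-□ f-lip h-lip .diagonal (a , c) =
  cong₂ _+_ (diagonal f-lip a) (diagonal h-lip c)
Lipschitz-□ f-lip h-lip .adjacent (b , e) (inj₁ (refl , c~c′)) =
  ≤-trans (+-monoʳ-≤ _ (adjacent h-lip e c~c′)) (≤-reflexive (+-suc _ _))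
Lipschitz-□ f-lip h-lip .adjacent (b , e) (inj₂ (refl , a~a′)) =
  +-monoˡ-≤ _ (adjacent f-lip b a~a′)

arcLength : ℕ → ℕ → ℕ
arcLength n t = t ⊓ (n ∸ t)

cycleDist : ℕ → ℕ → ℕ → ℕ
cycleDist n x y = arcLength n ∣ x - y ∣

WithinOne : ℕ → ℕ → Set
WithinOne p q = p ≤ suc q × q ≤ suc p

WithinOne-sym : ∀ {p q} → WithinOne p q → WithinOne q p
WithinOne-sym (p≤q+1 , q≤p+1) = q≤p+1 , p≤q+1

∸-suc : ∀ {t} → t < n → n ∸ t ≡ suc (n ∸ suc t)
∸-suc {suc n} {zero}  _         = refl
∸-suc {suc n} {suc t} (s≤s t<n) = ∸-suc t<n

arcLength-suc : ∀ {t} → t < n → WithinOne (arcLength n t) (arcLength n (suc t))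
arcLength-suc {n} {t} t<n =
    ⊓-mono-≤ (≤-trans (n≤1+n t) (n≤1+n _)) (≤-reflexive (∸-suc t<n))
  , ⊓-mono-≤ ≤-refl (≤-trans (∸-monoʳ-≤ n (n≤1+n t)) (n≤1+n _))

arcLength-complement : ∀ {t} → t ≤ n → arcLength n (n ∸ t) ≡ arcLength n t
arcLength-complement {n} {t} t≤n =
  trans (cong ((n ∸ t) ⊓_) (m∸[m∸n]≡n t≤n)) (⊓-comm (n ∸ t) t)

cycleDist-sym : ∀ x y → cycleDist n x y ≡ cycleDist n y x
cycleDist-sym {n} x y = cong (arcLength n) (∣-∣-comm x y)

cycleDist-≤ : ∀ {x y} → x ≤ y → cycleDist n x y ≡ arcLength n (y ∸ x)
cycleDist-≤ {n} x≤y = cong (arcLength n) (m≤n⇒∣m-n∣≡n∸m x≤y)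

∣-∣-suc : ∀ x y → (∣ suc x - y ∣ ≡ suc ∣ x - y ∣) ⊎ (∣ x - y ∣ ≡ suc ∣ suc x - y ∣)
∣-∣-suc x       zero    = inj₁ (cong suc (sym (∣-∣-identityʳ x)))
∣-∣-suc zero    (suc y) = inj₂ refl
∣-∣-suc (suc x) (suc y) = ∣-∣-suc x y

∣-∣-between : ∀ {x y z} → x ≤ y → y ≤ z → ∣ x - y ∣ + ∣ y - z ∣ ≡ ∣ x - z ∣
∣-∣-between {zero} {y} _ y≤z = trans (cong (y +_) (m≤n⇒∣m-n∣≡n∸m y≤z)) (m+[n∸m]≡n y≤z)
∣-∣-between (s≤s x≤y) (s≤s y≤z) = ∣-∣-between x≤y y≤z

∣-∣<n : ∀ {x y} → x < n → y < n → ∣ x - y ∣ < n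
∣-∣<n {x = x} {y} x<n y<n = ≤-<-trans (∣m-n∣≤m⊔n x y) (⊔-lub x<n y<n)

perimeter : ℕ → ℕ → ℕ → ℕ → ℕ
perimeter n x y z = cycleDist n x y + cycleDist n y z + cycleDist n x z

perimeter-rotate : ∀ x y z → perimeter n x y z ≡ perimeter n y z x
perimeter-rotate {n} x y z = trans (xy∙z≈yz∙x (cycleDist n x y) _ _)
  (cong₂ _+_ (cong (cycleDist n y z +_) (cycleDist-sym x z)) (cycleDist-sym x y))

perimeter-swap : ∀ x y z → perimeter n x y z ≡ perimeter n x z y
perimeter-swap {n} x y z = trans (xy∙z≈zy∙x (cycleDist n x y) _ _)
  (cong (λ t → cycleDist n x z + t + cycleDist n x y) (cycleDist-sym y z))

perimeter-sorted : ∀ {a b c} → a ≤ b → b ≤ c → c ≤ n → perimeter n a b c ≤ n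
perimeter-sorted {n} {a} {b} {c} a≤b b≤c c≤n = begin
  perimeter n a b c
    ≤⟨ +-mono-≤ (+-mono-≤ (m⊓n≤m ∣ a - b ∣ _) (m⊓n≤m ∣ b - c ∣ _)) (m⊓n≤n ∣ a - c ∣ _) ⟩
  ∣ a - b ∣ + ∣ b - c ∣ + (n ∸ ∣ a - c ∣)
    ≡⟨ cong (_+ (n ∸ ∣ a - c ∣)) (∣-∣-between a≤b b≤c) ⟩
  ∣ a - c ∣ + (n ∸ ∣ a - c ∣)
    ≡⟨ m+[n∸m]≡n ∣a-c∣≤n ⟩
  n ∎
  where
  open ≤-Reasoning
  ∣a-c∣≤n : ∣ a - c ∣ ≤ n
  ∣a-c∣≤n = ≤-trans (∣m-n∣≤m⊔n a c) (⊔-lub (≤-trans a≤b (≤-trans b≤c c≤n)) c≤n)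

perimeter-from-min : ∀ {a b c} → a ≤ b → a ≤ c → b ≤ n → c ≤ n → perimeter n a b c ≤ n
perimeter-from-min {n} {a} {b} {c} a≤b a≤c b≤n c≤n with ≤-total b c
... | inj₁ b≤c = perimeter-sorted a≤b b≤c c≤n
... | inj₂ c≤b = subst (_≤ n) (sym (perimeter-swap a b c)) (perimeter-sorted a≤c c≤b b≤n)

perimeter-≤ : ∀ {a b c} → a ≤ n → b ≤ n → c ≤ n → perimeter n a b c ≤ n
perimeter-≤ {n} {a} {b} {c} a≤n b≤n c≤n with ≤-total a b | ≤-total a c
... | inj₁ a≤b | inj₁ a≤c = perimeter-from-min a≤b a≤c b≤n c≤n
... | inj₁ a≤b | inj₂ c≤a = subst (_≤ n) (perimeter-rotate c a b)
                              (perimeter-from-min c≤a (≤-trans c≤a a≤b) a≤n b≤n)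
... | inj₂ b≤a | _ with ≤-total b c
...   | inj₁ b≤c = subst (_≤ n) (sym (perimeter-rotate a b c)) (perimeter-from-min b≤c b≤a c≤n a≤n)
...   | inj₂ c≤b = subst (_≤ n) (perimeter-rotate c a b)
                     (perimeter-from-min (≤-trans c≤b b≤a) c≤b a≤n b≤n)

cycleDist-antipodal : ∀ k → cycleDist (2 * k) 0 k ≡ k
cycleDist-antipodal k = begin
  k ⊓ (k + (k + 0) ∸ k) ≡⟨ cong (k ⊓_) (m+n∸m≡n k (k + 0)) ⟩
  k ⊓ (k + 0)           ≡⟨ cong (k ⊓_) (+-identityʳ k) ⟩
  k ⊓ k                 ≡⟨ ⊓-idem k ⟩
  k                     ∎
  where open ≡-Reasoning

C-sym : ∀ {a b : Fin n} → Adj (C n) a b → Adj (C n) b a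
C-sym (inj₁ s) = inj₂ s
C-sym (inj₂ s) = inj₁ s

descend : ∀ (a b : Fin n) d → toℕ a ≡ toℕ b + d → Walk (C n) a b d
descend a b zero eq =
  subst (λ c → Walk _ a c 0) (toℕ-injective (trans eq (+-identityʳ (toℕ b)))) nil
descend {n} a b (suc d) eq = cons (inj₂ (inj₁ a≡1+a′)) (descend a′ b d (toℕ-fromℕ< b+d<n))
  where
  b+d<n : toℕ b + d < n
  b+d<n = ≤-trans (≤-reflexive (sym (trans eq (+-suc _ _)))) (<⇒≤ (toℕ<n a))
  a′ : Fin n
  a′ = fromℕ< b+d<n
  a≡1+a′ : toℕ a ≡ suc (toℕ a′)
  a≡1+a′ = trans eq (trans (+-suc _ _) (cong suc (sym (toℕ-fromℕ< b+d<n))))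

climb : ∀ (a b : Fin n) → toℕ a ≤ toℕ b → Walk (C n) a b (toℕ b ∸ toℕ a)
climb a b a≤b = reverse C-sym (descend b a _ (sym (m+[n∸m]≡n a≤b)))

wrap-length : ∀ {x y n} → x ≤ y → y ≤ n → x + suc (n ∸ y) ≡ suc n ∸ (y ∸ x)
wrap-length {x} {y} {n} x≤y y≤n = sym (begin
  suc n ∸ (y ∸ x)                   ≡⟨ cong (_∸ (y ∸ x)) total ⟩
  (y ∸ x) + (x + suc r) ∸ (y ∸ x)   ≡⟨ m+n∸m≡n (y ∸ x) _ ⟩
  x + suc r                         ∎)
  where
  open ≡-Reasoning
  r = n ∸ y
  total : suc n ≡ (y ∸ x) + (x + suc r)
  total = begin
    suc n                 ≡⟨ cong suc (m+[n∸m]≡n y≤n) ⟨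
    suc (y + r)           ≡⟨ +-suc y r ⟨
    y + suc r             ≡⟨ cong (_+ suc r) (m∸n+n≡m x≤y) ⟨
    (y ∸ x) + x + suc r   ≡⟨ +-assoc (y ∸ x) x (suc r) ⟩
    (y ∸ x) + (x + suc r) ∎

-- Down from a to 0, across the edge 0 – (n-1), and down to b.
wrap-around : ∀ (a b : Fin (suc n)) → toℕ a ≤ toℕ b →
              Walk (C (suc n)) a b (suc n ∸ (toℕ b ∸ toℕ a))
wrap-around {n} a b a≤b = subst (Walk _ a b) (wrap-length a≤b b≤n)
  (descend a Fin.zero (toℕ a) refl
    ++ cons (inj₂ (inj₂ (cong suc (toℕ-fromℕ n) , refl)))
            (descend (fromℕ n) b (n ∸ toℕ b) (trans (toℕ-fromℕ n) (sym (m+[n∸m]≡n b≤n)))))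
  where
  b≤n : toℕ b ≤ n
  b≤n = ≤-pred (toℕ<n b)

dist-C : ∀ n → Fin n → Fin n → ℕ
dist-C n a b = cycleDist n (toℕ a) (toℕ b)

cycle-walk-≤ : ∀ (a b : Fin n) → toℕ a ≤ toℕ b → Walk (C n) a b (dist-C n a b)
cycle-walk-≤ {suc n} a b a≤b = subst (Walk _ a b) (sym (cycleDist-≤ a≤b)) shorter
  where
  shorter : Walk (C (suc n)) a b (arcLength (suc n) (toℕ b ∸ toℕ a))
  shorter with ⊓-sel (toℕ b ∸ toℕ a) (suc n ∸ (toℕ b ∸ toℕ a))
  ... | inj₁ eq = subst (Walk _ a b) (sym eq) (climb a b a≤b)
  ... | inj₂ eq = subst (Walk _ a b) (sym eq) (wrap-around a b a≤b)

cycle-walk : ∀ (a b : Fin n) → Walk (C n) a b (dist-C n a b)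
cycle-walk a b with ≤-total (toℕ a) (toℕ b)
... | inj₁ a≤b = cycle-walk-≤ a b a≤b
... | inj₂ b≤a = subst (Walk _ a b) (cycleDist-sym (toℕ b) (toℕ a))
                   (reverse C-sym (cycle-walk-≤ b a b≤a))

dist-C-Succ : ∀ {a a′} (b : Fin n) → Succ n a a′ → WithinOne (dist-C n a b) (dist-C n a′ b)
dist-C-Succ {n} {a} {a′} b (inj₁ a′≡1+a) =
  subst (λ t → WithinOne (dist-C n a b) (arcLength n ∣ t - y ∣)) (sym a′≡1+a) step
  where
  x = toℕ a
  y = toℕ b
  1+x<n : suc x < n
  1+x<n = subst (_< n) a′≡1+a (toℕ<n a′)
  step : WithinOne (cycleDist n x y) (cycleDist n (suc x) y)
  step with ∣-∣-suc x y
  ... | inj₁ eq = subst (λ t → WithinOne (cycleDist n x y) (arcLength n t)) (sym eq)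
                    (arcLength-suc (∣-∣<n (toℕ<n a) (toℕ<n b)))
  ... | inj₂ eq = subst (λ t → WithinOne (arcLength n t) (cycleDist n (suc x) y)) (sym eq)
                    (WithinOne-sym (arcLength-suc (∣-∣<n 1+x<n (toℕ<n b))))
dist-C-Succ {n} {a} {a′} b (inj₂ (1+a≡n , a′≡0)) = subst₂ WithinOne
  (sym (trans (cycleDist-sym x y) (cycleDist-≤ y≤x)))
  (sym (begin
    dist-C n a′ b        ≡⟨ cong (λ t → cycleDist n t y) a′≡0 ⟩
    arcLength n y        ≡⟨ arcLength-complement (<⇒≤ (toℕ<n b)) ⟨
    arcLength n (n ∸ y)  ≡⟨ cong (arcLength n) n-y≡1+x-y ⟩
    arcLength n (suc (x ∸ y)) ∎))
  (arcLength-suc (≤-trans (s≤s (m∸n≤m x y)) (≤-reflexive 1+a≡n)))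
  where
  open ≡-Reasoning
  x = toℕ a
  y = toℕ b
  y≤x : y ≤ x
  y≤x = ≤-pred (subst (y <_) (sym 1+a≡n) (toℕ<n b))
  n-y≡1+x-y : n ∸ y ≡ suc (x ∸ y)
  n-y≡1+x-y = trans (cong (_∸ y) (sym 1+a≡n)) (+-∸-assoc 1 y≤x)

C-Lipschitz : Lipschitz (C n) (dist-C n)
C-Lipschitz {n} .diagonal a = cong (arcLength n) (∣n-n∣≡0 (toℕ a))
C-Lipschitz .adjacent b (inj₁ s) = proj₁ (dist-C-Succ b s)
C-Lipschitz .adjacent b (inj₂ s) = proj₂ (dist-C-Succ b s)

torusDist : ∀ m n → V (C m □ C n) → V (C m □ C n) → ℕ
torusDist m n = dist-C m ⊕ dist-C n

torus-walk : ∀ (u v : V (C m □ C n)) → Walk (C m □ C n) u v (torusDist m n u v)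
torus-walk (a , c) (b , e) = walk-□ (cycle-walk a b) (cycle-walk c e)

torus-Lipschitz : Lipschitz (C m □ C n) (torusDist m n)
torus-Lipschitz = Lipschitz-□ C-Lipschitz C-Lipschitz

torus-Dist : ∀ {u v} → Dist (C m □ C n) u v d → d ≡ torusDist m n u v
torus-Dist {u = u} {v} = Dist-≡ torus-Lipschitz (torus-walk u v)

torus-perimeter : ∀ (u v w : V (C m □ C n)) →
  torusDist m n u v + torusDist m n v w + torusDist m n u w ≤ m + n
torus-perimeter {m} {n} (a₁ , a₂) (b₁ , b₂) (c₁ , c₂) = begin
  (d₁ a₁ b₁ + d₂ a₂ b₂) + (d₁ b₁ c₁ + d₂ b₂ c₂) + (d₁ a₁ c₁ + d₂ a₂ c₂)
    ≡⟨ cong (_+ (d₁ a₁ c₁ + d₂ a₂ c₂)) (interchange (d₁ a₁ b₁) _ _ _) ⟩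
  (d₁ a₁ b₁ + d₁ b₁ c₁) + (d₂ a₂ b₂ + d₂ b₂ c₂) + (d₁ a₁ c₁ + d₂ a₂ c₂)
    ≡⟨ interchange (d₁ a₁ b₁ + d₁ b₁ c₁) _ _ _ ⟩
  perimeter m (toℕ a₁) (toℕ b₁) (toℕ c₁) + perimeter n (toℕ a₂) (toℕ b₂) (toℕ c₂)
    ≤⟨ +-mono-≤ (perimeter-≤ (bound a₁) (bound b₁) (bound c₁))
                (perimeter-≤ (bound a₂) (bound b₂) (bound c₂)) ⟩
  m + n ∎
  where
  open ≤-Reasoning
  d₁ = dist-C m
  d₂ = dist-C n
  bound : ∀ {l} (i : Fin l) → toℕ i ≤ l
  bound i = <⇒≤ (toℕ<n i)

torus-diam-≥ : ∀ {k D} → 0 < k → Diam (C (2 * k) □ C (2 * k)) D → 2 * k ≤ D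
torus-diam-≥ {k} {D} 0<k (maximal , _) =
  subst (_≤ D) antipode (maximal P P′ _ (Dist-exact torus-Lipschitz (torus-walk P P′)))
  where
  0<2k : 0 < 2 * k
  0<2k = ≤-trans 0<k (m≤m+n k _)
  k<2k : k < 2 * k
  k<2k = m<m+n k (≤-trans 0<k (m≤m+n k 0))
  z h : Fin (2 * k)
  z = fromℕ< 0<2k
  h = fromℕ< k<2k
  P P′ : V (C (2 * k) □ C (2 * k))
  P  = z , z
  P′ = h , h
  dist-z-h : dist-C (2 * k) z h ≡ k
  dist-z-h = trans (cong₂ (cycleDist (2 * k)) (toℕ-fromℕ< 0<2k) (toℕ-fromℕ< k<2k))
                   (cycleDist-antipodal k)
  antipode : torusDist (2 * k) (2 * k) P P′ ≡ 2 * k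
  antipode = trans (cong₂ _+_ dist-z-h dist-z-h) (cong (k +_) (sym (+-identityʳ k)))

lemma2p1 : (k : ℕ) → 0 < k →
    (u v w : V (C (2 * k) □ C (2 * k))) →
    (duv dvw duw D : ℕ) →
    Dist (C (2 * k) □ C (2 * k)) u v duv →
    Dist (C (2 * k) □ C (2 * k)) v w dvw →
    Dist (C (2 * k) □ C (2 * k)) u w duw →
    Diam (C (2 * k) □ C (2 * k)) D →
    duv + dvw + duw ≤ 2 * D
lemma2p1 k 0<k u v w duv dvw duw D d-uv d-vw d-uw diam = begin
  duv + dvw + duw
    ≡⟨ cong₂ _+_ (cong₂ _+_ (torus-Dist d-uv) (torus-Dist d-vw)) (torus-Dist d-uw) ⟩
  δ u v + δ v w + δ u w
    ≤⟨ torus-perimeter u v w ⟩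
  2 * k + 2 * k
    ≤⟨ +-mono-≤ (torus-diam-≥ 0<k diam) (torus-diam-≥ 0<k diam) ⟩
  D + D
    ≡⟨ cong (D +_) (+-identityʳ D) ⟨
  2 * D ∎
  where
  open ≤-Reasoning
  δ = torusDist (2 * k) (2 * k)
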